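{- Let $B>1$ and $N>1$ be integers with $\gcd(N,B)=1$, let $e=\operatorname{ord}(B,N)$, and let $e=dk$ with $d,k$ positive integers. Let $x$ be an integer with $1\le x<N$ and $\gcd(x,N)=1$. Define the long-division sequences by $x_1=x$ and, for $i\ge1$, $a_i=\lfloor Bx_i/N\rfloor$ and $x_{i+1}=Bx_i-a_iN$ (so $0\le x_{i+1}<N$; the $a_i$ are the base-$B$ digits of $x/N=0.a_1a_2a_3\ldots$, which is purely periodic with period $a_1a_2\ldots a_e$). For $j=1,\dots,d$ let $A_j=\sum_{i=1}^{k} a_{(j-1)k+i}B^{k-i}$ (the number whose base-$B$ numeral is the $j$-th block $a_{(j-1)k+1}\ldots a_{jk}$ of the period), and set $$R_d(x)=\sum_{j=1}^d x_{(j-1)k+1},\qquad S_d(x)=\sum_{j=1}^d A_j .$$ Then $$S_d(x)=\frac{R_d(x)}{N}\,(B^k-1),$$ and $S_d(x)\equiv 0 \pmod{B^k-1}$ if and only if $R_d(x)\equiv 0\pmod N$.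
   Context: $\operatorname{ord}(B,N)$ denotes the multiplicative order of $B$ modulo $N$, i.e. the least positive integer $e$ with $B^e\equiv 1\pmod N$. -}

module Defs where

open import Data.Nat using (ℕ; zero; suc; _+_; _*_; _∸_; _^_; _<_; NonZero)
open import Data.Nat.DivMod using (_/_; _%_)
open import Data.Product using (_×_)

-- Multiplicative order: e is the least positive integer with B^e ≡ 1 (mod N).
-- (For N > 1, "B^e ≡ 1 (mod N)" is literally  B ^ e % N ≡ 1.)
open import Relation.Binary.PropositionalEquality using (_≡_)

IsOrd : (B N e : ℕ) → .{{NonZero N}} → Set
IsOrd B N e =
  (0 < e) × (B ^ e % N ≡ 1) × (∀ f → 0 < f → B ^ f % N ≡ 1 → e Data.Nat.≤ f)

-- Long-division remainders, 1-indexed: rem B N x i = x_i  (rem _ _ _ 0 is unused,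
-- we set it to x as well; only i ≥ 1 is used below).
-- x_1 = x,  x_{i+1} = B x_i - a_i N = (B x_i) mod N.
rem : (B N x : ℕ) → .{{NonZero N}} → ℕ → ℕ
rem B N x zero = x
rem B N x (suc zero) = x
rem B N x (suc (suc i)) = (B * rem B N x (suc i)) % N

digit : (B N x : ℕ) → .{{NonZero N}} → ℕ → ℕ
digit B N x i = (B * rem B N x i) / N

sum1 : ℕ → (ℕ → ℕ) → ℕ
sum1 zero f = 0
sum1 (suc n) f = sum1 n f + f (suc n)

block : (B N x k : ℕ) → .{{NonZero N}} → ℕ → ℕ
block B N x k j = sum1 k (λ i → digit B N x ((j ∸ 1) * k + i) * B ^ (k ∸ i))

Rsum : (B N x k d : ℕ) → .{{NonZero N}} → ℕ
Rsum B N x k d = sum1 d (λ j → rem B N x ((j ∸ 1) * k + 1))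

Ssum : (B N x k d : ℕ) → .{{NonZero N}} → ℕ
Ssum B N x k d = sum1 d (λ j → block B N x k j)

{-# OPTIONS --safe #-}
-- One step of long division reads B x_i = x_{i+1} + a_i N, and k steps of it give
-- N A + x_{b+k+1} = B^k x_{b+1} for the block A of digits a_{b+1} … a_{b+k}.
-- Summing over the d blocks, N S_d + Σ_{j=1}^{d} x_{jk+1} = B^k R_d.  Since
-- x_{i+1} = B^i x mod N, the remainder x_{dk+1} is x_1 again, so the shifted sum of
-- remainders is R_d itself and N S_d = R_d (B^k - 1); the divisibility equivalence is
-- cancellation in this identity.  Only B^{dk} ≡ 1 (mod N) is used, neither the
-- minimality of the order nor any coprimality.
module Submission where

open import Defs
open import Data.Nat using (ℕ; zero; suc; _+_; _*_; _∸_; _^_; _<_; _≤_; NonZero; >-nonZero)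
open import Data.Nat.GCD using (gcd)
open import Data.Nat.Divisibility using (_∣_; *-monoʳ-∣; *-monoˡ-∣; *-cancelʳ-∣; *-cancelˡ-∣)
open import Data.Nat.DivMod using (_%_; m≡m%n+[m/n]*n; %-distribˡ-*; m%n%n≡m%n; m<n⇒m%n≡m)
open import Data.Nat.Properties
open import Data.Nat.Solver using (module +-*-Solver)
open import Algebra.Properties.CommutativeSemigroup +-commutativeSemigroup
  using () renaming (interchange to +-interchange)
open import Algebra.Properties.CommutativeSemigroup *-commutativeSemigroup
  using () renaming (x∙yz≈y∙xz to *-exchange)
open import Data.Product using (_×_; _,_)
open import Function.Base using (_∘_)
open import Function.Bundles using (_⇔_; mk⇔)
open import Relation.Binary.PropositionalEquality
open ≡-Reasoning

sum1-cong : ∀ n {f g : ℕ → ℕ} → (∀ i → i < n → f (suc i) ≡ g (suc i)) →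
            sum1 n f ≡ sum1 n g
sum1-cong zero    f≗g = refl
sum1-cong (suc n) f≗g =
  cong₂ _+_ (sum1-cong n (λ i i<n → f≗g i (m<n⇒m<1+n i<n))) (f≗g n (n<1+n n))

sum1-+ : ∀ n (f g : ℕ → ℕ) → sum1 n (λ i → f i + g i) ≡ sum1 n f + sum1 n g
sum1-+ zero    f g = refl
sum1-+ (suc n) f g = begin
  sum1 n (λ i → f i + g i) + (f (suc n) + g (suc n))
    ≡⟨ cong (_+ (f (suc n) + g (suc n))) (sum1-+ n f g) ⟩
  (sum1 n f + sum1 n g) + (f (suc n) + g (suc n))
    ≡⟨ +-interchange (sum1 n f) (sum1 n g) (f (suc n)) (g (suc n)) ⟩
  sum1 (suc n) f + sum1 (suc n) g ∎

sum1-*ˡ : ∀ n c (f : ℕ → ℕ) → sum1 n (λ i → c * f i) ≡ c * sum1 n f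
sum1-*ˡ zero    c f = sym (*-zeroʳ c)
sum1-*ˡ (suc n) c f = begin
  sum1 n (λ i → c * f i) + c * f (suc n) ≡⟨ cong (_+ c * f (suc n)) (sum1-*ˡ n c f) ⟩
  c * sum1 n f + c * f (suc n)           ≡⟨ *-distribˡ-+ c (sum1 n f) (f (suc n)) ⟨
  c * sum1 (suc n) f                     ∎

sum1-suc : ∀ n (h : ℕ → ℕ) → sum1 (suc n) h ≡ h 1 + sum1 n (h ∘ suc)
sum1-suc zero    h = +-comm 0 (h 1)
sum1-suc (suc n) h = begin
  sum1 (suc n) h + h (suc (suc n))
    ≡⟨ cong (_+ h (suc (suc n))) (sum1-suc n h) ⟩
  (h 1 + sum1 n (h ∘ suc)) + h (suc (suc n))
    ≡⟨ +-assoc (h 1) (sum1 n (h ∘ suc)) (h (suc (suc n))) ⟩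
  h 1 + sum1 (suc n) (h ∘ suc) ∎

sum1-rotate : ∀ n (h : ℕ → ℕ) → h (suc n) ≡ h 1 → sum1 n (h ∘ suc) ≡ sum1 n h
sum1-rotate n h hₙ₊₁≡h₁ = +-cancelˡ-≡ (h 1) _ _ (begin
  h 1 + sum1 n (h ∘ suc) ≡⟨ sum1-suc n h ⟨
  sum1 n h + h (suc n)   ≡⟨ cong (sum1 n h +_) hₙ₊₁≡h₁ ⟩
  sum1 n h + h 1         ≡⟨ +-comm _ (h 1) ⟩
  h 1 + sum1 n h         ∎)

sum1-horner : ∀ B k (f : ℕ → ℕ) →
              sum1 (suc k) (λ i → f i * B ^ (suc k ∸ i))
                ≡ B * sum1 k (λ i → f i * B ^ (k ∸ i)) + f (suc k)
sum1-horner B k f = cong₂ _+_ shifted last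
  where
  shifted : sum1 k (λ i → f i * B ^ (suc k ∸ i)) ≡ B * sum1 k (λ i → f i * B ^ (k ∸ i))
  shifted = trans (sum1-cong k (λ i i<k → begin
      f (suc i) * B ^ (k ∸ i)             ≡⟨ cong (λ t → f (suc i) * B ^ t) (+-∸-assoc 1 i<k) ⟩
      f (suc i) * (B * B ^ (k ∸ suc i))   ≡⟨ *-exchange (f (suc i)) B _ ⟩
      B * (f (suc i) * B ^ (k ∸ suc i))   ∎))
    (sum1-*ˡ k B _)
  last : f (suc k) * B ^ (k ∸ k) ≡ f (suc k)
  last = trans (cong (λ t → f (suc k) * B ^ t) (n∸n≡0 k)) (*-identityʳ (f (suc k)))

m*[n%d]%d≡m*n%d : ∀ m n d .{{_ : NonZero d}} → m * (n % d) % d ≡ m * n % d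
m*[n%d]%d≡m*n%d m n d = begin
  m * (n % d) % d           ≡⟨ %-distribˡ-* m (n % d) d ⟩
  m % d * (n % d % d) % d   ≡⟨ cong (λ t → m % d * t % d) (m%n%n≡m%n n d) ⟩
  m % d * (n % d) % d       ≡⟨ %-distribˡ-* m n d ⟨
  m * n % d                 ∎

m+n≡o*n⇒m≡n*[o∸1] : ∀ {m n o} → m + n ≡ o * n → m ≡ n * (o ∸ 1)
m+n≡o*n⇒m≡n*[o∸1] {m} {n} {o} m+n≡o*n = begin
  m             ≡⟨ m+n∸n≡m m n ⟨
  m + n ∸ n     ≡⟨ cong₂ _∸_ (trans m+n≡o*n (*-comm o n)) (sym (*-identityʳ n)) ⟩
  n * o ∸ n * 1 ≡⟨ *-distribˡ-∸ n o 1 ⟨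
  n * (o ∸ 1)   ∎

*-cross-∣⇔ : ∀ {m n a b} .{{_ : NonZero m}} .{{_ : NonZero n}} →
             m * a ≡ b * n → n ∣ a ⇔ m ∣ b
*-cross-∣⇔ {m} {n} ma≡bn = mk⇔
  (λ n∣a → *-cancelʳ-∣ n (subst (m * n ∣_) ma≡bn (*-monoʳ-∣ m n∣a)))
  (λ m∣b → *-cancelˡ-∣ m (subst (m * n ∣_) (sym ma≡bn) (*-monoˡ-∣ n m∣b)))

module LongDivision (B N x : ℕ) .{{_ : NonZero N}} where

  r : ℕ → ℕ
  r = rem B N x

  a : ℕ → ℕ
  a = digit B N x

  rem-step : ∀ i → B * r (suc i) ≡ r (suc (suc i)) + a (suc i) * N
  rem-step i = m≡m%n+[m/n]*n (B * r (suc i)) N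

  rem-pow : x < N → ∀ i → r (suc i) ≡ B ^ i * x % N
  rem-pow x<N zero    = sym (trans (cong (_% N) (+-identityʳ x)) (m<n⇒m%n≡m x<N))
  rem-pow x<N (suc i) = begin
    B * r (suc i) % N        ≡⟨ cong (λ t → B * t % N) (rem-pow x<N i) ⟩
    B * (B ^ i * x % N) % N  ≡⟨ m*[n%d]%d≡m*n%d B (B ^ i * x) N ⟩
    B * (B ^ i * x) % N      ≡⟨ cong (_% N) (*-assoc B (B ^ i) x) ⟨
    B ^ suc i * x % N        ∎

  rem-period : x < N → ∀ e → B ^ e % N ≡ 1 → r (suc e) ≡ x
  rem-period x<N e Bᵉ%N≡1 = begin
    r (suc e)                 ≡⟨ rem-pow x<N e ⟩
    B ^ e * x % N             ≡⟨ %-distribˡ-* (B ^ e) x N ⟩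
    B ^ e % N * (x % N) % N   ≡⟨ cong (λ t → t * (x % N) % N) Bᵉ%N≡1 ⟩
    1 * (x % N) % N           ≡⟨ cong (_% N) (*-identityˡ (x % N)) ⟩
    x % N % N                 ≡⟨ m%n%n≡m%n x N ⟩
    x % N                     ≡⟨ m<n⇒m%n≡m x<N ⟩
    x                         ∎

  numeral : ℕ → ℕ → ℕ
  numeral b k = sum1 k (λ i → a (b + i) * B ^ (k ∸ i))

  numeral-suc : ∀ b k → numeral b (suc k) ≡ B * numeral b k + a (suc (b + k))
  numeral-suc b k = trans (sum1-horner B k (a ∘ (b +_)))
                          (cong (λ t → B * numeral b k + a t) (+-suc b k))

  numeral-rem : ∀ b k → N * numeral b k + r (suc (b + k)) ≡ B ^ k * r (suc b)
  numeral-rem b zero = trans (cong₂ (λ s t → s + r (suc t)) (*-zeroʳ N) (+-identityʳ b))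
                             (sym (*-identityˡ (r (suc b))))
  numeral-rem b (suc k) = begin
    N * numeral b (suc k) + r (suc (b + suc k))
      ≡⟨ cong₂ (λ s t → N * s + r (suc t)) (numeral-suc b k) (+-suc b k) ⟩
    N * (B * A + a (suc (b + k))) + r (suc (suc (b + k)))
      ≡⟨ regroup N B A (a (suc (b + k))) (r (suc (suc (b + k)))) ⟩
    B * (N * A) + (r (suc (suc (b + k))) + a (suc (b + k)) * N)
      ≡⟨ cong (B * (N * A) +_) (rem-step (b + k)) ⟨
    B * (N * A) + B * r (suc (b + k))
      ≡⟨ *-distribˡ-+ B (N * A) (r (suc (b + k))) ⟨
    B * (N * A + r (suc (b + k)))
      ≡⟨ cong (B *_) (numeral-rem b k) ⟩
    B * (B ^ k * r (suc b))
      ≡⟨ *-assoc B (B ^ k) (r (suc b)) ⟨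
    B ^ suc k * r (suc b) ∎
    where
    A : ℕ
    A = numeral b k
    open +-*-Solver using (solve; _:=_; _:+_; _:*_)
    regroup : ∀ n b s c t → n * (b * s + c) + t ≡ b * (n * s) + (t + c * n)
    regroup = solve 5 (λ n b s c t → n :* (b :* s :+ c) :+ t
                                   := b :* (n :* s) :+ (t :+ c :* n)) refl

  -- block B N x k (suc j) unfolds to numeral (j * k) k.
  block-rem : ∀ k j → N * block B N x k (suc j) + r (suc j * k + 1)
                        ≡ B ^ k * r (j * k + 1)
  block-rem k j = begin
    N * numeral (j * k) k + r (suc j * k + 1)   ≡⟨ cong (λ t → N * numeral (j * k) k + r t) index ⟩
    N * numeral (j * k) k + r (suc (j * k + k)) ≡⟨ numeral-rem (j * k) k ⟩
    B ^ k * r (suc (j * k))                     ≡⟨ cong (λ t → B ^ k * r t) (+-comm 1 (j * k)) ⟩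
    B ^ k * r (j * k + 1)                       ∎
    where
    index : suc j * k + 1 ≡ suc (j * k + k)
    index = trans (+-comm (suc j * k) 1) (cong suc (+-comm k (j * k)))

  Ssum-Rsum : ∀ k d → N * Ssum B N x k d + sum1 d (λ j → r (j * k + 1))
                        ≡ B ^ k * Rsum B N x k d
  Ssum-Rsum k d = begin
    N * Ssum B N x k d + sum1 d (h ∘ suc)
      ≡⟨ cong (_+ sum1 d (h ∘ suc)) (sum1-*ˡ d N (block B N x k)) ⟨
    sum1 d (λ j → N * block B N x k j) + sum1 d (h ∘ suc)
      ≡⟨ sum1-+ d (λ j → N * block B N x k j) (h ∘ suc) ⟨
    sum1 d (λ j → N * block B N x k j + h (suc j))
      ≡⟨ sum1-cong d (λ j _ → block-rem k j) ⟩
    sum1 d (λ j → B ^ k * h j)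
      ≡⟨ sum1-*ˡ d (B ^ k) h ⟩
    B ^ k * Rsum B N x k d ∎
    where
    h : ℕ → ℕ
    h j = r ((j ∸ 1) * k + 1)

  Rsum-rotate : x < N → ∀ k d → B ^ (d * k) % N ≡ 1 →
                sum1 d (λ j → r (j * k + 1)) ≡ Rsum B N x k d
  Rsum-rotate x<N k d Bᵈᵏ%N≡1 = sum1-rotate d (λ j → r ((j ∸ 1) * k + 1))
    (trans (cong r (+-comm (d * k) 1)) (rem-period x<N (d * k) Bᵈᵏ%N≡1))

  N*Ssum≡Rsum*[Bᵏ∸1] : x < N → ∀ k d → B ^ (d * k) % N ≡ 1 →
                       N * Ssum B N x k d ≡ Rsum B N x k d * (B ^ k ∸ 1)
  N*Ssum≡Rsum*[Bᵏ∸1] x<N k d Bᵈᵏ%N≡1 = m+n≡o*n⇒m≡n*[o∸1] {o = B ^ k} (begin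
    N * Ssum B N x k d + Rsum B N x k d
      ≡⟨ cong (N * Ssum B N x k d +_) (Rsum-rotate x<N k d Bᵈᵏ%N≡1) ⟨
    N * Ssum B N x k d + sum1 d (λ j → r (j * k + 1))
      ≡⟨ Ssum-Rsum k d ⟩
    B ^ k * Rsum B N x k d ∎)

theorem1 : (B N : ℕ) → .{{_ : NonZero N}} → 1 < B → 1 < N → gcd N B ≡ 1 →
           (e d k : ℕ) → IsOrd B N e → 0 < d → 0 < k → e ≡ d * k →
           (x : ℕ) → 1 ≤ x → x < N → gcd x N ≡ 1 →
           (N * Ssum B N x k d ≡ Rsum B N x k d * (B ^ k ∸ 1))
           × ((B ^ k ∸ 1) ∣ Ssum B N x k d ⇔ N ∣ Rsum B N x k d)
theorem1 B N 1<B _ _ e d k (_ , Bᵉ%N≡1 , _) _ 0<k refl x _ x<N _ =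
  NS≡R[Bᵏ∸1] , *-cross-∣⇔ NS≡R[Bᵏ∸1]
  where
  open LongDivision B N x
  NS≡R[Bᵏ∸1] : N * Ssum B N x k d ≡ Rsum B N x k d * (B ^ k ∸ 1)
  NS≡R[Bᵏ∸1] = N*Ssum≡Rsum*[Bᵏ∸1] x<N k d Bᵉ%N≡1
  instance
    Bᵏ∸1≢0 : NonZero (B ^ k ∸ 1)
    Bᵏ∸1≢0 = >-nonZero (m<n⇒0<n∸m (^-monoʳ-< B 1<B 0<k))
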